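{- Let $\alpha$ be a nonzero integer and let $(h_n)$ be the sequence with $h_0=0$, $h_1=1$, $h_2=-\alpha$, $h_3=-\alpha^3$, $h_4=\alpha^6$, and for $m\ge2$: $h_{2m+1}=h_{m+2}h_m^3-h_{m-1}h_{m+1}^3$, for $m\ge 3$: $h_{2m}=h_m\big(h_{m+2}h_{m-1}^2-h_{m-2}h_{m+1}^2\big)/h_2$. (i) $h_n$ is a square for all positive integers $n$ not divisible by $5$ if and only if $\alpha$ is a square. (ii) $h_n$ is a cube for all positive integers $n$ not divisible by $5$ if and only if $\alpha$ is a cube.
   Context: The sequence defined is the elliptic divisibility sequence attached to the point $(0,0)$ of order $5$ on $y^2+(1-\alpha)xy-\alpha y=x^3-\alpha x^2$; $h_n=0$ exactly when $5\mid n$. Convention: an integer $m$ is called a square if $m=\pm\beta^2$ for some nonzero integer $\beta$, and a cube if $m=\beta^3$ for some nonzero integer $\beta$. -}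

module Defs where

open import Data.Nat.Base as ℕ using (ℕ; zero; suc; ⌊_/2⌋; parity; _∸_)
open import Data.Parity.Base using (Parity; 0ℙ; 1ℙ)
open import Data.Integer.Base using (ℤ; +_; -_; _+_; _-_; _*_; _^_; NonZero; ≢-nonZero; 0ℤ; _/_)
open import Data.Integer.Properties using (neg-injective)
open import Data.Product using (∃; _×_; _,_)
open import Data.Sum using (_⊎_)
open import Relation.Binary.PropositionalEquality using (_≡_; _≢_)

neg≢0 : ∀ {α : ℤ} → α ≢ 0ℤ → - α ≢ 0ℤ
neg≢0 α≢0 e = α≢0 (neg-injective e)

-- For n ≥ 5, with m = ⌊n/2⌋:
--   n = 2m+1 (so m ≥ 2):  h_{m+2} h_m^3 - h_{m-1} h_{m+1}^3
--   n = 2m   (so m ≥ 3):  h_m (h_{m+2} h_{m-1}^2 - h_{m-2} h_{m+1}^2) / h_2,  h_2 = -α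
-- ('/' is stdlib integer division; the division is exact.)
hStep : (α : ℤ) → α ≢ 0ℤ → (ℕ → ℤ) → ℕ → ℤ
hStep α nz g 0 = + 0
hStep α nz g 1 = + 1
hStep α nz g 2 = - α
hStep α nz g 3 = - (α ^ 3)
hStep α nz g 4 = α ^ 6
hStep α nz g n@(suc (suc (suc (suc (suc _))))) with parity n
... | 1ℙ = g (m ℕ.+ 2) * g m ^ 3 - g (m ∸ 1) * g (m ℕ.+ 1) ^ 3
  where m = ⌊ n /2⌋
... | 0ℙ = (g m * (g (m ℕ.+ 2) * g (m ∸ 1) ^ 2 - g (m ∸ 2) * g (m ℕ.+ 1) ^ 2))
             / (- α)
  where
    m = ⌊ n /2⌋
    instance
      nz' : NonZero (- α)
      nz' = ≢-nonZero (neg≢0 nz)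

-- Fuel-indexed evaluation; every recursive index used at n is < n,
-- so fuel n+1 suffices.
hFuel : (α : ℤ) → α ≢ 0ℤ → ℕ → ℕ → ℤ
hFuel α nz zero    n = + 0
hFuel α nz (suc f) n = hStep α nz (hFuel α nz f) n

h : (α : ℤ) → α ≢ 0ℤ → ℕ → ℤ
h α nz n = hFuel α nz (suc n) n

IsSquare : ℤ → Set
IsSquare m = ∃ λ (β : ℤ) → β ≢ 0ℤ × (m ≡ β ^ 2 ⊎ m ≡ - (β ^ 2))

IsCube : ℤ → Set
IsCube m = ∃ λ (β : ℤ) → β ≢ 0ℤ × m ≡ β ^ 3

-- The sequence has the closed form  h_n = ε_n α^(e_n)  with sign ε_n ∈ {0, ±1}
-- and exponent e_n (= ⌊2n²/5⌋ for 5 ∤ n) given by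
--   ε_0..ε_4 = 0, 1, -1, -1, 1,   ε_(n+5) = - ε_n,
--   e_0..e_4 = 0, 0,  1,  3, 6,   e_(n+5) = e_n + 4n + 10,
-- so that  h_(n+5) = - α^(4n+10) h_n.
module Submission where

open import Defs
open import Data.Nat.Base using (ℕ; _≥_)
open import Data.Nat.Divisibility using (_∣_)
open import Data.Integer.Base using (ℤ; 0ℤ)
open import Data.Product using (_×_)
open import Function.Bundles using (_⇔_)
open import Relation.Binary.PropositionalEquality using (_≢_)
open import Relation.Nullary using (¬_)

import Data.Nat.Base as ℕ
open import Data.Nat.Base using (zero; suc; _<_; ⌊_/2⌋; parity; s≤s; z≤n)
open import Data.Nat.Properties using (_<?_)
import Data.Nat.Properties as ℕP
import Data.Nat.DivMod as ℕD
open import Data.Nat.Divisibility using (_∣?_; _∣0; ∣m∣n⇒∣m+n; ∣-refl)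
open import Data.Parity.Base using (0ℙ; 1ℙ)
open import Data.Integer.Base
  using (1ℤ; -1ℤ; +_; -[1+_]; -_; _-_; _*_; _^_; NonZero; ≢-nonZero; _/_; _/ℕ_)
import Data.Integer.Properties as ℤP
open import Data.Product using (_,_)
open import Data.Sum using (_⊎_; inj₁; inj₂)
open import Data.Empty using (⊥-elim)
open import Function.Base using (_∘_)
open import Function.Bundles using (mk⇔)
open import Relation.Nullary.Decidable using (from-no; True; toWitness)
open import Relation.Binary.PropositionalEquality
  using (_≡_; refl; sym; trans; cong; cong₂; subst; module ≡-Reasoning)
open ≡-Reasoning

-- The right-hand sides of the two recursions: for n = 2m+1 the value is
-- oddRule h_(m+2) h_m h_(m-1) h_(m+1), for n = 2m it is
-- evenRule h_m h_(m+2) h_(m-1) h_(m-2) h_(m+1) divided by h_2.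
oddRule : ℤ → ℤ → ℤ → ℤ → ℤ
oddRule x₁ x₂ x₃ x₄ = x₁ * x₂ ^ 3 - x₃ * x₄ ^ 3

evenRule : ℤ → ℤ → ℤ → ℤ → ℤ → ℤ
evenRule x₀ x₁ x₂ x₃ x₄ = x₀ * (x₁ * x₂ ^ 2 - x₃ * x₄ ^ 2)

oddRule-cong : ∀ {x₁ x₂ x₃ x₄ y₁ y₂ y₃ y₄} →
  x₁ ≡ y₁ → x₂ ≡ y₂ → x₃ ≡ y₃ → x₄ ≡ y₄ → oddRule x₁ x₂ x₃ x₄ ≡ oddRule y₁ y₂ y₃ y₄
oddRule-cong refl refl refl refl = refl

evenRule-cong : ∀ {x₀ x₁ x₂ x₃ x₄ y₀ y₁ y₂ y₃ y₄} →
  x₀ ≡ y₀ → x₁ ≡ y₁ → x₂ ≡ y₂ → x₃ ≡ y₃ → x₄ ≡ y₄ →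
  evenRule x₀ x₁ x₂ x₃ x₄ ≡ evenRule y₀ y₁ y₂ y₃ y₄
evenRule-cong refl refl refl refl refl = refl

-- The recursions for a sequence g at the indices 2m+1 with m = 2 + k and
-- 2m with m = 3 + k.
oddAt : (ℕ → ℤ) → ℕ → ℤ
oddAt g k = oddRule (g (4 ℕ.+ k)) (g (2 ℕ.+ k)) (g (1 ℕ.+ k)) (g (3 ℕ.+ k))

evenAt : (ℕ → ℤ) → ℕ → ℤ
evenAt g k = evenRule (g (3 ℕ.+ k)) (g (5 ℕ.+ k)) (g (2 ℕ.+ k)) (g (1 ℕ.+ k)) (g (4 ℕ.+ k))

-- Ring normalisations used below (powers are written out as products,
-- which is how x ^ 2 and x ^ 3 unfold).
module RingIdentities where
  open import Data.Integer.Tactic.RingSolver using (solve-∀)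

  oddRule-expand : ∀ p₁ p₂ p₃ p₄ x₁ x₂ x₃ x₄ →
    (- p₁ * x₁) * ((- p₂ * x₂) * ((- p₂ * x₂) * ((- p₂ * x₂) * 1ℤ)))
      - (- p₃ * x₃) * ((- p₄ * x₄) * ((- p₄ * x₄) * ((- p₄ * x₄) * 1ℤ)))
    ≡ (p₁ * (p₂ * (p₂ * (p₂ * 1ℤ)))) * (x₁ * (x₂ * (x₂ * (x₂ * 1ℤ))))
      - (p₃ * (p₄ * (p₄ * (p₄ * 1ℤ)))) * (x₃ * (x₄ * (x₄ * (x₄ * 1ℤ))))
  oddRule-expand = solve-∀

  evenRule-expand : ∀ p₀ p₁ p₂ p₃ p₄ x₀ x₁ x₂ x₃ x₄ →
    (- p₀ * x₀) * ((- p₁ * x₁) * ((- p₂ * x₂) * ((- p₂ * x₂) * 1ℤ))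
                   - (- p₃ * x₃) * ((- p₄ * x₄) * ((- p₄ * x₄) * 1ℤ)))
    ≡ (p₀ * (p₁ * (p₂ * (p₂ * 1ℤ)))) * (x₀ * (x₁ * (x₂ * (x₂ * 1ℤ))))
      - (p₀ * (p₃ * (p₄ * (p₄ * 1ℤ)))) * (x₀ * (x₃ * (x₄ * (x₄ * 1ℤ))))
  evenRule-expand = solve-∀

  factor-difference : ∀ p a b → p * a - p * b ≡ p * (a - b)
  factor-difference = solve-∀

  factor-difference₂ : ∀ p x a b → p * (x * a) - p * (x * b) ≡ p * (x * (a - b))
  factor-difference₂ = solve-∀

  factor-differenceʳ : ∀ s t x → s * x - t * x ≡ (s - t) * x
  factor-differenceʳ = solve-∀

  interchange : ∀ s a t b → (s * a) * (t * b) ≡ (s * t) * (a * b)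
  interchange = solve-∀

  neg-swap : ∀ a x → (- a) * x ≡ (- x) * a
  neg-swap = solve-∀

  square-product : ∀ b c → (b * (b * 1ℤ)) * (c * (c * 1ℤ)) ≡ (b * c) * ((b * c) * 1ℤ)
  square-product = solve-∀

  square-product-negʳ : ∀ b c → (b * (b * 1ℤ)) * - (c * (c * 1ℤ)) ≡ - ((b * c) * ((b * c) * 1ℤ))
  square-product-negʳ = solve-∀

  square-product-negˡ : ∀ b c → - (b * (b * 1ℤ)) * (c * (c * 1ℤ)) ≡ - ((b * c) * ((b * c) * 1ℤ))
  square-product-negˡ = solve-∀

  square-product-neg : ∀ b c → - (b * (b * 1ℤ)) * - (c * (c * 1ℤ)) ≡ (b * c) * ((b * c) * 1ℤ)
  square-product-neg = solve-∀

  cube-product : ∀ b c → (b * (b * (b * 1ℤ))) * (c * (c * (c * 1ℤ)))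
                         ≡ (b * c) * ((b * c) * ((b * c) * 1ℤ))
  cube-product = solve-∀

  cube-neg : ∀ b → - (b * (b * (b * 1ℤ))) ≡ (- b) * ((- b) * ((- b) * 1ℤ))
  cube-neg = solve-∀

  negate-twice : ∀ p q x → - p * (- q * x) ≡ (p * q) * x
  negate-twice = solve-∀

  neg-shift : ∀ s p q → - s * (p * q) ≡ - p * (s * q)
  neg-shift = solve-∀

  swap-front : ∀ p a b → p * (a * b) ≡ a * (p * b)
  swap-front = solve-∀

oddRule-scaling : ∀ p₁ p₂ p₃ p₄ {x₁ x₂ x₃ x₄} → p₁ * p₂ ^ 3 ≡ p₃ * p₄ ^ 3 →
  oddRule (- p₁ * x₁) (- p₂ * x₂) (- p₃ * x₃) (- p₄ * x₄)
    ≡ (p₁ * p₂ ^ 3) * oddRule x₁ x₂ x₃ x₄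
oddRule-scaling p₁ p₂ p₃ p₄ {x₁} {x₂} {x₃} {x₄} balanced = begin
  oddRule (- p₁ * x₁) (- p₂ * x₂) (- p₃ * x₃) (- p₄ * x₄)
    ≡⟨ RingIdentities.oddRule-expand p₁ p₂ p₃ p₄ x₁ x₂ x₃ x₄ ⟩
  (p₁ * p₂ ^ 3) * (x₁ * x₂ ^ 3) - (p₃ * p₄ ^ 3) * (x₃ * x₄ ^ 3)
    ≡⟨ cong (λ q → (p₁ * p₂ ^ 3) * (x₁ * x₂ ^ 3) - q * (x₃ * x₄ ^ 3)) (sym balanced) ⟩
  (p₁ * p₂ ^ 3) * (x₁ * x₂ ^ 3) - (p₁ * p₂ ^ 3) * (x₃ * x₄ ^ 3)
    ≡⟨ RingIdentities.factor-difference (p₁ * p₂ ^ 3) _ _ ⟩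
  (p₁ * p₂ ^ 3) * oddRule x₁ x₂ x₃ x₄ ∎

evenRule-scaling : ∀ p₀ p₁ p₂ p₃ p₄ {x₀ x₁ x₂ x₃ x₄} → p₁ * p₂ ^ 2 ≡ p₃ * p₄ ^ 2 →
  evenRule (- p₀ * x₀) (- p₁ * x₁) (- p₂ * x₂) (- p₃ * x₃) (- p₄ * x₄)
    ≡ (p₀ * (p₁ * p₂ ^ 2)) * evenRule x₀ x₁ x₂ x₃ x₄
evenRule-scaling p₀ p₁ p₂ p₃ p₄ {x₀} {x₁} {x₂} {x₃} {x₄} balanced = begin
  evenRule (- p₀ * x₀) (- p₁ * x₁) (- p₂ * x₂) (- p₃ * x₃) (- p₄ * x₄)
    ≡⟨ RingIdentities.evenRule-expand p₀ p₁ p₂ p₃ p₄ x₀ x₁ x₂ x₃ x₄ ⟩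
  (p₀ * (p₁ * p₂ ^ 2)) * (x₀ * (x₁ * x₂ ^ 2)) - (p₀ * (p₃ * p₄ ^ 2)) * (x₀ * (x₃ * x₄ ^ 2))
    ≡⟨ cong (λ q → (p₀ * (p₁ * p₂ ^ 2)) * (x₀ * (x₁ * x₂ ^ 2)) - (p₀ * q) * (x₀ * (x₃ * x₄ ^ 2)))
            (sym balanced) ⟩
  (p₀ * (p₁ * p₂ ^ 2)) * (x₀ * (x₁ * x₂ ^ 2)) - (p₀ * (p₁ * p₂ ^ 2)) * (x₀ * (x₃ * x₄ ^ 2))
    ≡⟨ RingIdentities.factor-difference₂ (p₀ * (p₁ * p₂ ^ 2)) x₀ _ _ ⟩
  (p₀ * (p₁ * p₂ ^ 2)) * evenRule x₀ x₁ x₂ x₃ x₄ ∎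

-- The remainder of the multiple (n+1)(k+1), in the form the division of
-- -[1+ _ ] by k+1 inspects.
multiple-remainder : ∀ n k → suc (k ℕ.+ n ℕ.* suc k) ℕD.% suc k ≡ 0
multiple-remainder n k = ℕD.m*n%n≡0 (suc n) (suc k)

divℕ-exact : ∀ x k → (x * + suc k) /ℕ suc k ≡ x
divℕ-exact (+ zero)  k = refl
divℕ-exact (+ suc n) k = cong +_ (ℕD.m*n/n≡m (suc n) (suc k))
divℕ-exact -[1+ n ]  k rewrite multiple-remainder n k =
  cong (λ q → - (+ q)) (ℕD.m*n/n≡m (suc n) (suc k))

exact-division : ∀ d x .{{_ : NonZero d}} → (d * x) / d ≡ x
exact-division (+ suc k) x = begin
  1ℤ * ((+ suc k * x) /ℕ suc k)   ≡⟨ ℤP.*-identityˡ _ ⟩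
  (+ suc k * x) /ℕ suc k          ≡⟨ cong (_/ℕ suc k) (ℤP.*-comm (+ suc k) x) ⟩
  (x * + suc k) /ℕ suc k          ≡⟨ divℕ-exact x k ⟩
  x                               ∎
exact-division -[1+ k ] x = begin
  -1ℤ * ((-[1+ k ] * x) /ℕ suc k)    ≡⟨ cong (λ y → -1ℤ * (y /ℕ suc k))
                                              (RingIdentities.neg-swap (+ suc k) x) ⟩
  -1ℤ * (((- x) * + suc k) /ℕ suc k) ≡⟨ cong (-1ℤ *_) (divℕ-exact (- x) k) ⟩
  -1ℤ * (- x)                        ≡⟨ ℤP.-1*i≡-i (- x) ⟩
  - (- x)                            ≡⟨ ℤP.neg-involutive x ⟩
  x                                  ∎

-- Exponent bookkeeping for the powers of α produced by shifting indices.
module Exponents where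
  open import Data.Nat.Tactic.RingSolver using (solve-∀)

  double : ∀ n → (4 ℕ.* (5 ℕ.+ n) ℕ.+ 10) ℕ.+ (4 ℕ.* n ℕ.+ 10) ≡ 8 ℕ.* n ℕ.+ 40
  double = solve-∀

  odd₁ : ∀ k → (4 ℕ.* (4 ℕ.+ k) ℕ.+ 10) ℕ.+ (4 ℕ.* (2 ℕ.+ k) ℕ.+ 10) ℕ.* 3
               ≡ 8 ℕ.* (5 ℕ.+ (k ℕ.+ k)) ℕ.+ 40
  odd₁ = solve-∀

  odd₂ : ∀ k → (4 ℕ.* (1 ℕ.+ k) ℕ.+ 10) ℕ.+ (4 ℕ.* (3 ℕ.+ k) ℕ.+ 10) ℕ.* 3
               ≡ 8 ℕ.* (5 ℕ.+ (k ℕ.+ k)) ℕ.+ 40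
  odd₂ = solve-∀

  even₁ : ∀ k → (4 ℕ.* (3 ℕ.+ k) ℕ.+ 10)
                  ℕ.+ ((4 ℕ.* (5 ℕ.+ k) ℕ.+ 10) ℕ.+ (4 ℕ.* (2 ℕ.+ k) ℕ.+ 10) ℕ.* 2)
                ≡ 8 ℕ.* (6 ℕ.+ (k ℕ.+ k)) ℕ.+ 40
  even₁ = solve-∀

  even₂ : ∀ k → (4 ℕ.* (5 ℕ.+ k) ℕ.+ 10) ℕ.+ (4 ℕ.* (2 ℕ.+ k) ℕ.+ 10) ℕ.* 2
                ≡ (4 ℕ.* (1 ℕ.+ k) ℕ.+ 10) ℕ.+ (4 ℕ.* (4 ℕ.+ k) ℕ.+ 10) ℕ.* 2
  even₂ = solve-∀

  index : ∀ d k → d ℕ.+ ((5 ℕ.+ k) ℕ.+ (5 ℕ.+ k)) ≡ 10 ℕ.+ (d ℕ.+ (k ℕ.+ k))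
  index = solve-∀

-- The closed form

module ClosedForm (α : ℤ) where

  -- A monomial s α^n.  It is kept opaque: the lemmas below are the only
  -- way its value is used, so comparing two monomials with numeral signs
  -- and exponents never unfolds the power of α.
  opaque
    mono : ℤ → ℕ → ℤ
    mono s n = s * α ^ n

    mono-unfold : ∀ s n → mono s n ≡ s * α ^ n
    mono-unfold s n = refl

    mono-product : ∀ s m t n → mono s m * mono t n ≡ mono (s * t) (m ℕ.+ n)
    mono-product s m t n = begin
      (s * α ^ m) * (t * α ^ n)   ≡⟨ RingIdentities.interchange s (α ^ m) t (α ^ n) ⟩
      (s * t) * (α ^ m * α ^ n)   ≡⟨ cong ((s * t) *_) (ℤP.^-distribˡ-+-* α m n) ⟨
      (s * t) * α ^ (m ℕ.+ n)     ∎

    mono-power : ∀ t n j → mono t n ^ j ≡ mono (t ^ j) (j ℕ.* n)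
    mono-power t n zero    = sym (ℤP.*-identityʳ 1ℤ)
    mono-power t n (suc j) = begin
      mono t n * mono t n ^ j           ≡⟨ cong (mono t n *_) (mono-power t n j) ⟩
      mono t n * mono (t ^ j) (j ℕ.* n) ≡⟨ mono-product t n (t ^ j) (j ℕ.* n) ⟩
      mono (t ^ suc j) (suc j ℕ.* n)    ∎

    mono-shift : ∀ s a b → mono (- s) (a ℕ.+ b) ≡ - α ^ a * mono s b
    mono-shift s a b = begin
      - s * α ^ (a ℕ.+ b)      ≡⟨ cong (- s *_) (ℤP.^-distribˡ-+-* α a b) ⟩
      - s * (α ^ a * α ^ b)    ≡⟨ RingIdentities.neg-shift s (α ^ a) (α ^ b) ⟩
      - α ^ a * (s * α ^ b)    ∎

    mono-difference : ∀ {s t n} → mono s n - mono t n ≡ mono (s - t) n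
    mono-difference {s} {t} {n} = RingIdentities.factor-differenceʳ s t (α ^ n)

    mono-difference-zeroʳ : ∀ {s m n} → mono s m - mono 0ℤ n ≡ mono s m
    mono-difference-zeroʳ {s} {m} = ℤP.+-identityʳ (mono s m)

    mono-difference-zeroˡ : ∀ {m s n} → mono 0ℤ m - mono s n ≡ mono (- s) n
    mono-difference-zeroˡ {s = s} {n} =
      trans (ℤP.+-identityˡ (- mono s n)) (ℤP.neg-distribˡ-* s (α ^ n))

    mono-zero : ∀ {m n} → mono 0ℤ m ≡ mono 0ℤ n
    mono-zero = refl

  mono-times-power : ∀ s m t n j →
    mono s m * mono t n ^ j ≡ mono (s * t ^ j) (m ℕ.+ j ℕ.* n)
  mono-times-power s m t n j =
    trans (cong (mono s m *_) (mono-power t n j)) (mono-product s m (t ^ j) (j ℕ.* n))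

  neg-α-mono : ∀ s n → - α * mono s n ≡ mono (- s) (suc n)
  neg-α-mono s n =
    sym (trans (mono-shift s 1 n) (cong (λ x → - x * mono s n) (ℤP.*-identityʳ α)))

  -- Shifting the index by 5 multiplies by - α^(r n).
  r : ℕ → ℕ
  r n = 4 ℕ.* n ℕ.+ 10

  ε : ℕ → ℤ
  ε 0 = 0ℤ
  ε 1 = 1ℤ
  ε 2 = -1ℤ
  ε 3 = -1ℤ
  ε 4 = 1ℤ
  ε (suc (suc (suc (suc (suc n))))) = - ε n

  e : ℕ → ℕ
  e 0 = 0
  e 1 = 0
  e 2 = 1
  e 3 = 3
  e 4 = 6
  e (suc (suc (suc (suc (suc n))))) = r n ℕ.+ e n

  c : ℕ → ℤ
  c n = mono (ε n) (e n)

  ρ : ℕ → ℤ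
  ρ n = α ^ r n

  shift : ∀ n → c (5 ℕ.+ n) ≡ - ρ n * c n
  shift n = mono-shift (ε n) (r n) (e n)

  power-product : ∀ m n j → α ^ m * (α ^ n) ^ j ≡ α ^ (m ℕ.+ n ℕ.* j)
  power-product m n j = trans (cong (α ^ m *_) (ℤP.^-*-assoc α n j))
                              (sym (ℤP.^-distribˡ-+-* α m (n ℕ.* j)))

  double-shift : ∀ n → c (10 ℕ.+ n) ≡ α ^ (8 ℕ.* n ℕ.+ 40) * c n
  double-shift n = begin
    c (5 ℕ.+ (5 ℕ.+ n))              ≡⟨ shift (5 ℕ.+ n) ⟩
    - ρ (5 ℕ.+ n) * c (5 ℕ.+ n)      ≡⟨ cong (- ρ (5 ℕ.+ n) *_) (shift n) ⟩
    - ρ (5 ℕ.+ n) * (- ρ n * c n)    ≡⟨ RingIdentities.negate-twice (ρ (5 ℕ.+ n)) (ρ n) (c n) ⟩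
    (ρ (5 ℕ.+ n) * ρ n) * c n
      ≡⟨ cong (_* c n) (trans (sym (ℤP.^-distribˡ-+-* α (r (5 ℕ.+ n)) (r n)))
                              (cong (α ^_) (Exponents.double n))) ⟩
    α ^ (8 ℕ.* n ℕ.+ 40) * c n       ∎

  -- The two recursions hold for c (the division by h_2 = - α is written
  -- as a multiplication).
  OddIdentity : ℕ → Set
  OddIdentity k = oddAt c k ≡ c (5 ℕ.+ (k ℕ.+ k))

  EvenIdentity : ℕ → Set
  EvenIdentity k = evenAt c k ≡ - α * c (6 ℕ.+ (k ℕ.+ k))

  -- Step: the identities at k + 5 are those at k multiplied by α^(16k+80)
  -- resp. α^(16k+88).
  odd-factor : ∀ k → ρ (4 ℕ.+ k) * ρ (2 ℕ.+ k) ^ 3 ≡ α ^ (8 ℕ.* (5 ℕ.+ (k ℕ.+ k)) ℕ.+ 40)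
  odd-factor k =
    trans (power-product (r (4 ℕ.+ k)) (r (2 ℕ.+ k)) 3) (cong (α ^_) (Exponents.odd₁ k))

  odd-balance : ∀ k → ρ (4 ℕ.+ k) * ρ (2 ℕ.+ k) ^ 3 ≡ ρ (1 ℕ.+ k) * ρ (3 ℕ.+ k) ^ 3
  odd-balance k = trans (odd-factor k) (sym
    (trans (power-product (r (1 ℕ.+ k)) (r (3 ℕ.+ k)) 3) (cong (α ^_) (Exponents.odd₂ k))))

  odd-step : ∀ k → OddIdentity k → OddIdentity (5 ℕ.+ k)
  odd-step k ih = begin
    oddAt c (5 ℕ.+ k)
      ≡⟨ oddRule-cong (shift (4 ℕ.+ k)) (shift (2 ℕ.+ k)) (shift (1 ℕ.+ k)) (shift (3 ℕ.+ k)) ⟩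
    oddRule (- ρ (4 ℕ.+ k) * c (4 ℕ.+ k)) (- ρ (2 ℕ.+ k) * c (2 ℕ.+ k))
            (- ρ (1 ℕ.+ k) * c (1 ℕ.+ k)) (- ρ (3 ℕ.+ k) * c (3 ℕ.+ k))
      ≡⟨ oddRule-scaling (ρ (4 ℕ.+ k)) (ρ (2 ℕ.+ k)) (ρ (1 ℕ.+ k)) (ρ (3 ℕ.+ k))
                         (odd-balance k) ⟩
    (ρ (4 ℕ.+ k) * ρ (2 ℕ.+ k) ^ 3) * oddAt c k
      ≡⟨ cong₂ _*_ (odd-factor k) ih ⟩
    α ^ (8 ℕ.* (5 ℕ.+ (k ℕ.+ k)) ℕ.+ 40) * c (5 ℕ.+ (k ℕ.+ k))
      ≡⟨ sym (double-shift (5 ℕ.+ (k ℕ.+ k))) ⟩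
    c (10 ℕ.+ (5 ℕ.+ (k ℕ.+ k)))
      ≡⟨ cong c (sym (Exponents.index 5 k)) ⟩
    c (5 ℕ.+ ((5 ℕ.+ k) ℕ.+ (5 ℕ.+ k))) ∎

  even-factor : ∀ k → ρ (3 ℕ.+ k) * (ρ (5 ℕ.+ k) * ρ (2 ℕ.+ k) ^ 2)
                      ≡ α ^ (8 ℕ.* (6 ℕ.+ (k ℕ.+ k)) ℕ.+ 40)
  even-factor k = begin
    ρ (3 ℕ.+ k) * (ρ (5 ℕ.+ k) * ρ (2 ℕ.+ k) ^ 2)
      ≡⟨ cong (ρ (3 ℕ.+ k) *_) (power-product (r (5 ℕ.+ k)) (r (2 ℕ.+ k)) 2) ⟩
    ρ (3 ℕ.+ k) * α ^ (r (5 ℕ.+ k) ℕ.+ r (2 ℕ.+ k) ℕ.* 2)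
      ≡⟨ sym (ℤP.^-distribˡ-+-* α (r (3 ℕ.+ k)) (r (5 ℕ.+ k) ℕ.+ r (2 ℕ.+ k) ℕ.* 2)) ⟩
    α ^ (r (3 ℕ.+ k) ℕ.+ (r (5 ℕ.+ k) ℕ.+ r (2 ℕ.+ k) ℕ.* 2))
      ≡⟨ cong (α ^_) (Exponents.even₁ k) ⟩
    α ^ (8 ℕ.* (6 ℕ.+ (k ℕ.+ k)) ℕ.+ 40) ∎

  even-balance : ∀ k → ρ (5 ℕ.+ k) * ρ (2 ℕ.+ k) ^ 2 ≡ ρ (1 ℕ.+ k) * ρ (4 ℕ.+ k) ^ 2
  even-balance k = begin
    ρ (5 ℕ.+ k) * ρ (2 ℕ.+ k) ^ 2           ≡⟨ power-product (r (5 ℕ.+ k)) (r (2 ℕ.+ k)) 2 ⟩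
    α ^ (r (5 ℕ.+ k) ℕ.+ r (2 ℕ.+ k) ℕ.* 2) ≡⟨ cong (α ^_) (Exponents.even₂ k) ⟩
    α ^ (r (1 ℕ.+ k) ℕ.+ r (4 ℕ.+ k) ℕ.* 2) ≡⟨ power-product (r (1 ℕ.+ k)) (r (4 ℕ.+ k)) 2 ⟨
    ρ (1 ℕ.+ k) * ρ (4 ℕ.+ k) ^ 2           ∎

  even-step : ∀ k → EvenIdentity k → EvenIdentity (5 ℕ.+ k)
  even-step k ih = begin
    evenAt c (5 ℕ.+ k)
      ≡⟨ evenRule-cong (shift (3 ℕ.+ k)) (shift (5 ℕ.+ k)) (shift (2 ℕ.+ k))
                       (shift (1 ℕ.+ k)) (shift (4 ℕ.+ k)) ⟩
    evenRule (- ρ (3 ℕ.+ k) * c (3 ℕ.+ k)) (- ρ (5 ℕ.+ k) * c (5 ℕ.+ k))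
             (- ρ (2 ℕ.+ k) * c (2 ℕ.+ k)) (- ρ (1 ℕ.+ k) * c (1 ℕ.+ k))
             (- ρ (4 ℕ.+ k) * c (4 ℕ.+ k))
      ≡⟨ evenRule-scaling (ρ (3 ℕ.+ k)) (ρ (5 ℕ.+ k)) (ρ (2 ℕ.+ k)) (ρ (1 ℕ.+ k)) (ρ (4 ℕ.+ k))
                         (even-balance k) ⟩
    (ρ (3 ℕ.+ k) * (ρ (5 ℕ.+ k) * ρ (2 ℕ.+ k) ^ 2)) * evenAt c k
      ≡⟨ cong₂ _*_ (even-factor k) ih ⟩
    α ^ (8 ℕ.* (6 ℕ.+ (k ℕ.+ k)) ℕ.+ 40) * (- α * c (6 ℕ.+ (k ℕ.+ k)))
      ≡⟨ RingIdentities.swap-front (α ^ (8 ℕ.* (6 ℕ.+ (k ℕ.+ k)) ℕ.+ 40)) (- α)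
                                   (c (6 ℕ.+ (k ℕ.+ k))) ⟩
    - α * (α ^ (8 ℕ.* (6 ℕ.+ (k ℕ.+ k)) ℕ.+ 40) * c (6 ℕ.+ (k ℕ.+ k)))
      ≡⟨ cong (- α *_) (sym (double-shift (6 ℕ.+ (k ℕ.+ k)))) ⟩
    - α * c (10 ℕ.+ (6 ℕ.+ (k ℕ.+ k)))
      ≡⟨ cong (λ n → - α * c n) (sym (Exponents.index 6 k)) ⟩
    - α * c (6 ℕ.+ ((5 ℕ.+ k) ℕ.+ (5 ℕ.+ k))) ∎

  -- For explicit k all signs and exponents are numerals, so
  -- after writing both sides as monomials only a difference of two
  -- monomials remains to be simplified; the final comparison of signs and
  -- exponents is by computation.
  oddDifference : ℕ → ℤ
  oddDifference k =
    mono (ε (4 ℕ.+ k) * ε (2 ℕ.+ k) ^ 3) (e (4 ℕ.+ k) ℕ.+ 3 ℕ.* e (2 ℕ.+ k))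
      - mono (ε (1 ℕ.+ k) * ε (3 ℕ.+ k) ^ 3) (e (1 ℕ.+ k) ℕ.+ 3 ℕ.* e (3 ℕ.+ k))

  evenDifference : ℕ → ℤ
  evenDifference k =
    mono (ε (5 ℕ.+ k) * ε (2 ℕ.+ k) ^ 2) (e (5 ℕ.+ k) ℕ.+ 2 ℕ.* e (2 ℕ.+ k))
      - mono (ε (1 ℕ.+ k) * ε (4 ℕ.+ k) ^ 2) (e (1 ℕ.+ k) ℕ.+ 2 ℕ.* e (4 ℕ.+ k))

  oddAt-monomial : ∀ k → oddAt c k ≡ oddDifference k
  oddAt-monomial k = cong₂ _-_
    (mono-times-power (ε (4 ℕ.+ k)) (e (4 ℕ.+ k)) (ε (2 ℕ.+ k)) (e (2 ℕ.+ k)) 3)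
    (mono-times-power (ε (1 ℕ.+ k)) (e (1 ℕ.+ k)) (ε (3 ℕ.+ k)) (e (3 ℕ.+ k)) 3)

  evenAt-monomial : ∀ k → evenAt c k ≡ c (3 ℕ.+ k) * evenDifference k
  evenAt-monomial k = cong (c (3 ℕ.+ k) *_) (cong₂ _-_
    (mono-times-power (ε (5 ℕ.+ k)) (e (5 ℕ.+ k)) (ε (2 ℕ.+ k)) (e (2 ℕ.+ k)) 2)
    (mono-times-power (ε (1 ℕ.+ k)) (e (1 ℕ.+ k)) (ε (4 ℕ.+ k)) (e (4 ℕ.+ k)) 2))

  odd-base : ∀ k {s n} → oddDifference k ≡ mono s n → mono s n ≡ c (5 ℕ.+ (k ℕ.+ k)) →
             OddIdentity k
  odd-base k difference computed = trans (oddAt-monomial k) (trans difference computed)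

  even-base : ∀ k {s n} → evenDifference k ≡ mono s n →
    mono (ε (3 ℕ.+ k) * s) (e (3 ℕ.+ k) ℕ.+ n)
      ≡ mono (- ε (6 ℕ.+ (k ℕ.+ k))) (suc (e (6 ℕ.+ (k ℕ.+ k)))) →
    EvenIdentity k
  even-base k {s} {n} difference computed = begin
    evenAt c k                                    ≡⟨ evenAt-monomial k ⟩
    c (3 ℕ.+ k) * evenDifference k                ≡⟨ cong (c (3 ℕ.+ k) *_) difference ⟩
    c (3 ℕ.+ k) * mono s n                        ≡⟨ mono-product (ε (3 ℕ.+ k)) (e (3 ℕ.+ k)) s n ⟩
    mono (ε (3 ℕ.+ k) * s) (e (3 ℕ.+ k) ℕ.+ n)    ≡⟨ computed ⟩
    mono (- ε (6 ℕ.+ (k ℕ.+ k))) (suc (e (6 ℕ.+ (k ℕ.+ k))))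
      ≡⟨ neg-α-mono (ε (6 ℕ.+ (k ℕ.+ k))) (e (6 ℕ.+ (k ℕ.+ k))) ⟨
    - α * c (6 ℕ.+ (k ℕ.+ k))                     ∎

  -- The identities by induction on k in steps of 5.  In each base case the
  -- inner difference has equal exponents or a vanishing term.
  oddIdentity : ∀ k → OddIdentity k
  oddIdentity 0 = odd-base 0 mono-difference mono-zero
  oddIdentity 1 = odd-base 1 mono-difference refl
  oddIdentity 2 = odd-base 2 mono-difference-zeroʳ refl
  oddIdentity 3 = odd-base 3 mono-difference-zeroˡ refl
  oddIdentity 4 = odd-base 4 mono-difference refl
  oddIdentity (suc (suc (suc (suc (suc k))))) = odd-step k (oddIdentity k)

  evenIdentity : ∀ k → EvenIdentity k
  evenIdentity 0 = even-base 0 mono-difference refl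
  evenIdentity 1 = even-base 1 mono-difference-zeroʳ refl
  evenIdentity 2 = even-base 2 mono-difference mono-zero
  evenIdentity 3 = even-base 3 mono-difference-zeroˡ refl
  evenIdentity 4 = even-base 4 mono-difference refl
  evenIdentity (suc (suc (suc (suc (suc k))))) = even-step k (evenIdentity k)

-- Agreement of the recursively defined sequence with the closed form

-- Writing an index ≥ 5 as 5 + (k + k) or 6 + (k + k) determines which
-- branch of the recursion is taken.
data EvenOdd : ℕ → Set where
  even : ∀ k → EvenOdd (k ℕ.+ k)
  odd  : ∀ k → EvenOdd (suc (k ℕ.+ k))

evenOdd : ∀ n → EvenOdd n
evenOdd zero = even zero
evenOdd (suc n) with evenOdd n
... | even k = odd k
... | odd k  = subst EvenOdd (cong suc (ℕP.+-suc k k)) (even (suc k))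

parity-even : ∀ k → parity (k ℕ.+ k) ≡ 0ℙ
parity-even zero    = refl
parity-even (suc k) rewrite ℕP.+-suc k k = parity-even k

parity-odd : ∀ k → parity (suc (k ℕ.+ k)) ≡ 1ℙ
parity-odd zero    = refl
parity-odd (suc k) rewrite ℕP.+-suc k k = parity-odd k

half-even : ∀ k → ⌊ k ℕ.+ k /2⌋ ≡ k
half-even zero    = refl
half-even (suc k) rewrite ℕP.+-suc k k = cong suc (half-even k)

half-odd : ∀ k → ⌊ suc (k ℕ.+ k) /2⌋ ≡ k
half-odd zero    = refl
half-odd (suc k) rewrite ℕP.+-suc k k = cong suc (half-odd k)

module Agreement (α : ℤ) (nz : α ≢ 0ℤ) where
  open ClosedForm α

  instance
    h₂-nonZero : NonZero (- α)
    h₂-nonZero = ≢-nonZero (neg≢0 nz)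

  hStep-odd : ∀ g k → hStep α nz g (5 ℕ.+ (k ℕ.+ k)) ≡ oddAt g k
  hStep-odd g k rewrite parity-odd k | half-odd k | ℕP.+-comm k 2 | ℕP.+-comm k 1 = refl

  hStep-even : ∀ g k → hStep α nz g (6 ℕ.+ (k ℕ.+ k)) ≡ evenAt g k / (- α)
  hStep-even g k rewrite parity-even k | half-even k | ℕP.+-comm k 2 | ℕP.+-comm k 1 = refl

  window : ∀ {g : ℕ → ℤ} {d} k → (∀ i → i < d ℕ.+ (k ℕ.+ k) → g i ≡ c i) →
           ∀ j {j<d : True (j <? d)} → g (j ℕ.+ k) ≡ c (j ℕ.+ k)
  window k agree j {j<d} = agree (j ℕ.+ k) (ℕP.+-mono-<-≤ (toWitness j<d) (ℕP.m≤m+n k k))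

  step-agrees : ∀ n g → (∀ i → i < n → g i ≡ c i) → hStep α nz g n ≡ c n
  step-agrees 0 g _ = sym (mono-unfold 0ℤ 0)
  step-agrees 1 g _ = sym (mono-unfold 1ℤ 0)
  step-agrees 2 g _ =
    sym (trans (mono-unfold -1ℤ 1) (trans (ℤP.-1*i≡-i (α * 1ℤ)) (cong -_ (ℤP.*-identityʳ α))))
  step-agrees 3 g _ = sym (trans (mono-unfold -1ℤ 3) (ℤP.-1*i≡-i (α ^ 3)))
  step-agrees 4 g _ = sym (trans (mono-unfold 1ℤ 6) (ℤP.*-identityˡ (α ^ 6)))
  step-agrees (suc (suc (suc (suc (suc n))))) g agree with evenOdd n
  ... | even k = begin
    hStep α nz g (5 ℕ.+ (k ℕ.+ k))   ≡⟨ hStep-odd g k ⟩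
    oddAt g k                          ≡⟨ oddRule-cong (below 4) (below 2) (below 1) (below 3) ⟩
    oddAt c k                          ≡⟨ oddIdentity k ⟩
    c (5 ℕ.+ (k ℕ.+ k))               ∎
    where below = window {g} {5} k agree
  ... | odd k = begin
    hStep α nz g (6 ℕ.+ (k ℕ.+ k))   ≡⟨ hStep-even g k ⟩
    evenAt g k / (- α)                 ≡⟨ cong (_/ (- α)) (evenRule-cong (below 3) (below 5)
                                                            (below 2) (below 1) (below 4)) ⟩
    evenAt c k / (- α)                 ≡⟨ cong (_/ (- α)) (evenIdentity k) ⟩
    (- α * c (6 ℕ.+ (k ℕ.+ k))) / (- α) ≡⟨ exact-division (- α) (c (6 ℕ.+ (k ℕ.+ k))) ⟩
    c (6 ℕ.+ (k ℕ.+ k))               ∎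
    where below = window {g} {6} k agree

  hFuel-agrees : ∀ f n → n < f → hFuel α nz f n ≡ c n
  hFuel-agrees (suc f) n (s≤s n≤f) =
    step-agrees n (hFuel α nz f) (λ i i<n → hFuel-agrees f i (ℕP.<-≤-trans i<n n≤f))

  h-closed-form : ∀ n → h α nz n ≡ c n
  h-closed-form n = hFuel-agrees (suc n) n (ℕP.n<1+n n)

-- Multiplicative classes

record MultiplicativeClass (P : ℤ → Set) : Set where
  field
    one : P 1ℤ
    neg : ∀ {x} → P x → P (- x)
    mul : ∀ {x y} → P x → P y → P (x * y)

module _ {P : ℤ → Set} (class : MultiplicativeClass P) where
  open MultiplicativeClass class

  power : ∀ {a} → P a → ∀ n → P (a ^ n)
  power pa zero    = one
  power pa (suc n) = mul pa (power pa n)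

  neg-reflect : ∀ {x} → P (- x) → P x
  neg-reflect {x} p = subst P (ℤP.neg-involutive x) (neg p)

  closed-form-in-class : ∀ {α} → P α → ∀ n → ¬ 5 ∣ n → P (ClosedForm.c α n)
  closed-form-in-class {α} pα = member
    where
    open ClosedForm α

    monomial : ∀ {s} n → P s → P (mono s n)
    monomial {s} n ps = subst P (sym (mono-unfold s n)) (mul ps (power pα n))

    member : ∀ n → ¬ 5 ∣ n → P (c n)
    member 0 5∤0 = ⊥-elim (5∤0 (5 ∣0))
    member 1 _   = monomial 0 one
    member 2 _   = monomial 1 (neg one)
    member 3 _   = monomial 3 (neg one)
    member 4 _   = monomial 6 one
    member (suc (suc (suc (suc (suc n))))) 5∤n+5 =
      subst P (sym (shift n))
        (mul (neg (power pα (r n))) (member n (5∤n+5 ∘ ∣m∣n⇒∣m+n ∣-refl)))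

  characterisation : ∀ α (nz : α ≢ 0ℤ) →
    ((n : ℕ) → n ≥ 1 → ¬ (5 ∣ n) → P (h α nz n)) ⇔ P α
  characterisation α nz = mk⇔
    (λ all → neg-reflect (all 2 (s≤s z≤n) (from-no (5 ∣? 2))))
    (λ pα n _ 5∤n →
       subst P (sym (Agreement.h-closed-form α nz n)) (closed-form-in-class pα n 5∤n))

nonzero-product : ∀ {β γ : ℤ} → β ≢ 0ℤ → γ ≢ 0ℤ → β * γ ≢ 0ℤ
nonzero-product {β} β≢0 γ≢0 βγ≡0 with ℤP.i*j≡0⇒i≡0∨j≡0 β βγ≡0
... | inj₁ β≡0 = β≢0 β≡0
... | inj₂ γ≡0 = γ≢0 γ≡0

squares : MultiplicativeClass IsSquare
squares = record
  { one = 1ℤ , (λ ()) , inj₁ refl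
  ; neg = λ where
      (β , β≢0 , inj₁ refl) → β , β≢0 , inj₂ refl
      (β , β≢0 , inj₂ refl) → β , β≢0 , inj₁ (ℤP.neg-involutive (β ^ 2))
  ; mul = λ where
      (β , β≢0 , sx) (γ , γ≢0 , sy) →
        β * γ , nonzero-product β≢0 γ≢0 , product {β = β} {γ} sx sy
  }
  where
  open RingIdentities
  product : ∀ {x y β γ} → x ≡ β ^ 2 ⊎ x ≡ - (β ^ 2) → y ≡ γ ^ 2 ⊎ y ≡ - (γ ^ 2) →
            x * y ≡ (β * γ) ^ 2 ⊎ x * y ≡ - ((β * γ) ^ 2)
  product {β = β} {γ} (inj₁ refl) (inj₁ refl) = inj₁ (square-product β γ)
  product {β = β} {γ} (inj₁ refl) (inj₂ refl) = inj₂ (square-product-negʳ β γ)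
  product {β = β} {γ} (inj₂ refl) (inj₁ refl) = inj₂ (square-product-negˡ β γ)
  product {β = β} {γ} (inj₂ refl) (inj₂ refl) = inj₁ (square-product-neg β γ)

cubes : MultiplicativeClass IsCube
cubes = record
  { one = 1ℤ , (λ ()) , refl
  ; neg = λ where
      (β , β≢0 , refl) → - β , β≢0 ∘ ℤP.neg-injective , RingIdentities.cube-neg β
  ; mul = λ where
      (β , β≢0 , refl) (γ , γ≢0 , refl) →
        β * γ , nonzero-product β≢0 γ≢0 , RingIdentities.cube-product β γ
  }

theorem5p4 : (α : ℤ) (nz : α ≢ 0ℤ) →
    (((n : ℕ) → n ≥ 1 → ¬ (5 ∣ n) → IsSquare (h α nz n)) ⇔ IsSquare α)
    × (((n : ℕ) → n ≥ 1 → ¬ (5 ∣ n) → IsCube (h α nz n)) ⇔ IsCube α)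
theorem5p4 α nz = characterisation squares α nz , characterisation cubes α nz
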